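{- Let $k\ge 2$, let $G$ be a complete $k$-partite graph with partite sets $V_1,\dots,V_k$, and let $A$ be an abelian group. A map $l:V(G)\to A\setminus\{0\}$ is an $A$-vertex magic labeling of $G$ if and only if $\sum_{v\in V_1} l(v)=\sum_{v\in V_2} l(v)=\cdots=\sum_{v\in V_k} l(v)$. In particular, $G$ is $A$-vertex magic if and only if there is a labeling $l:V(G)\to A\setminus\{0\}$ for which the sums of labels over the partite sets are all equal.
   Context: For an additive abelian group $A$ with identity $0$ and a graph $G$, an $A$-vertex magic labeling of $G$ is a map $l:V(G)\to A\setminus\{0\}$ for which there is $\mu\in A$ such that $\sum_{u\in N_G(v)} l(u)=\mu$ for every $v\in V(G)$. $G$ is $A$-vertex magic if such a labeling exists. -}

module Defs where

open import Level using (Level; _⊔_)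
open import Data.Nat using (ℕ; zero; suc)
open import Data.Fin using (Fin; zero; suc; _≟_)
open import Data.Bool using (Bool; true; false; if_then_else_; not)
open import Data.Product using (Σ; ∃; _×_; _,_)
open import Relation.Nullary using (¬_)
open import Relation.Nullary.Decidable using (⌊_⌋)
open import Relation.Binary.PropositionalEquality using (_≡_)
open import Algebra.Bundles using (AbelianGroup)

record Graph : Set where
  field
    n     : ℕ
    adj   : Fin n → Fin n → Bool
    adj-sym : ∀ u v → adj u v ≡ adj v u
    adj-irrefl : ∀ v → adj v v ≡ false
open Graph public

module _ {c ℓ : Level} (A : AbelianGroup c ℓ) where
  open AbelianGroup A

  ∑ : (m : ℕ) → (Fin m → Carrier) → Carrier
  ∑ zero    f = ε
  ∑ (suc m) f = f zero ∙ ∑ m (λ i → f (suc i))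

  nbrSum : (G : Graph) → (Fin (n G) → Carrier) → Fin (n G) → Carrier
  nbrSum G l v = ∑ (n G) (λ u → if adj G v u then l u else ε)

  IsVertexMagicLabeling : (G : Graph) → (Fin (n G) → Carrier) → Set (c ⊔ ℓ)
  IsVertexMagicLabeling G l =
    (∀ v → ¬ (l v ≈ ε)) × (Σ Carrier λ μ → ∀ v → nbrSum G l v ≈ μ)

  IsVertexMagic : Graph → Set (c ⊔ ℓ)
  IsVertexMagic G = Σ (Fin (n G) → Carrier) λ l → IsVertexMagicLabeling G l

  partSum : {N k : ℕ} → (part : Fin N → Fin k) → (Fin N → Carrier) → Fin k → Carrier
  partSum {N} part l i = ∑ N (λ v → if ⌊ part v ≟ i ⌋ then l v else ε)

-- The complete k-partite graph on vertex set Fin N whose partite sets are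
-- the fibres of part : Fin N → Fin k  (u ~ v iff part u ≠ part v).
completeMultipartite : (N k : ℕ) → (Fin N → Fin k) → Graph
completeMultipartite N k part = record
  { n = N
  ; adj = λ u v → not ⌊ part u ≟ part v ⌋
  ; adj-sym = symProof
  ; adj-irrefl = irr
  }
  where
  open import Relation.Nullary using (yes; no)
  open import Relation.Binary.PropositionalEquality using (refl; sym)
  symProof : ∀ u v → not ⌊ part u ≟ part v ⌋ ≡ not ⌊ part v ≟ part u ⌋
  symProof u v with part u ≟ part v | part v ≟ part u
  ... | yes _ | yes _ = refl
  ... | no _  | no _  = refl
  ... | yes p | no q = Data.Empty.⊥-elim (q (sym p)) where import Data.Empty
  ... | no p  | yes q = Data.Empty.⊥-elim (p (sym q)) where import Data.Empty
  irr : ∀ v → not ⌊ part v ≟ part v ⌋ ≡ false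
  irr v with part v ≟ part v
  ... | yes _ = refl
  ... | no ¬p = Data.Empty.⊥-elim (¬p refl) where import Data.Empty

{-# OPTIONS --safe #-}
module Submission where

open import Defs
open import Level using (Level)
open import Data.Nat using (ℕ; zero; suc; _≤_)
open import Data.Fin using (Fin; zero; suc; _≟_)
open import Data.Bool using (Bool; true; false; if_then_else_; not)
open import Data.Product using (Σ; ∃; _×_; _,_)
open import Relation.Nullary using (¬_)
open import Relation.Nullary.Decidable using (⌊_⌋)
open import Relation.Binary.PropositionalEquality as ≡ using (_≡_)
open import Function.Base using (_∘_)
open import Function.Bundles using (_⇔_; mk⇔; module Equivalence)
open import Algebra.Bundles using (AbelianGroup)
import Algebra.Properties.CommutativeMonoid.Sum as CommutativeMonoidSum
import Algebra.Properties.Group as GroupProperties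
import Relation.Binary.Reasoning.Setoid as SetoidReasoning

-- Every vertex v of a complete multipartite graph is adjacent to exactly the
-- vertices outside its own part, so  nbrSum v + partSum (part v)  is the sum
-- of all labels, independently of v.  Hence the neighbourhood sums are all
-- equal iff the sums over the parts met by some vertex are, and with every
-- part nonempty that is all of them.

module _ {c ℓ : Level} (A : AbelianGroup c ℓ) where
  open AbelianGroup A
  open CommutativeMonoidSum commutativeMonoid using (sum; sum-cong-≋; ∑-distrib-+)
  open GroupProperties group using (∙-cancelˡ; ∙-cancelʳ)
  open SetoidReasoning setoid

  ∑≡sum : ∀ m (f : Fin m → Carrier) → ∑ A m f ≡ sum f
  ∑≡sum zero    f = ≡.refl
  ∑≡sum (suc m) f = ≡.cong (f zero ∙_) (∑≡sum m (f ∘ suc))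

  if-not∙if≈ : ∀ (b : Bool) x → (if not b then x else ε) ∙ (if b then x else ε) ≈ x
  if-not∙if≈ true  x = identityˡ x
  if-not∙if≈ false x = identityʳ x

  pairwise≈⇒constant : ∀ {m} (f : Fin m → Carrier) → (∀ u v → f u ≈ f v) →
                       Σ Carrier λ μ → ∀ v → f v ≈ μ
  pairwise≈⇒constant {zero}  f _ = ε , λ ()
  pairwise≈⇒constant {suc m} f h = f zero , λ v → h v zero

  module _ {N k : ℕ} (part : Fin N → Fin k) (l : Fin N → Carrier) where
    private
      G = completeMultipartite N k part

    nbrSum∙partSum≈∑ : ∀ v → nbrSum A G l v ∙ partSum A part l (part v) ≈ ∑ A N l
    nbrSum∙partSum≈∑ v = begin
      nbrSum A G l v ∙ partSum A part l (part v)  ≡⟨ ≡.cong₂ _∙_ (∑≡sum N adjacent) (∑≡sum N sameParted) ⟩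
      sum adjacent ∙ sum sameParted               ≈⟨ ∑-distrib-+ adjacent sameParted ⟨
      sum (λ u → adjacent u ∙ sameParted u)       ≈⟨ sum-cong-≋ split ⟩
      sum l                                       ≡⟨ ∑≡sum N l ⟨
      ∑ A N l                                     ∎
      where
      adjacent sameParted : Fin N → Carrier
      adjacent    u = if adj G v u then l u else ε
      sameParted  u = if ⌊ part u ≟ part v ⌋ then l u else ε

      split : ∀ u → adjacent u ∙ sameParted u ≈ l u
      split u rewrite adj-sym G v u = if-not∙if≈ ⌊ part u ≟ part v ⌋ (l u)

    nbrSum≈⇔partSum≈ : ∀ u v → nbrSum A G l u ≈ nbrSum A G l v
                               ⇔ partSum A part l (part u) ≈ partSum A part l (part v)
    nbrSum≈⇔partSum≈ u v = mk⇔
      (λ e → ∙-cancelˡ _ _ _ (trans (∙-congʳ (sym e)) sums≈))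
      (λ e → ∙-cancelʳ _ _ _ (trans (∙-congˡ (sym e)) sums≈))
      where
      sums≈ : nbrSum A G l u ∙ partSum A part l (part u) ≈ nbrSum A G l v ∙ partSum A part l (part v)
      sums≈ = trans (nbrSum∙partSum≈∑ u) (sym (nbrSum∙partSum≈∑ v))

    vertexMagic⇔partSums≈ : (∀ i → ∃ λ v → part v ≡ i) → (∀ v → ¬ l v ≈ ε) →
                            IsVertexMagicLabeling A G l ⇔ (∀ i j → partSum A part l i ≈ partSum A part l j)
    vertexMagic⇔partSums≈ surj nonzero = mk⇔ partSums≈ (λ h → nonzero , nbrSums-constant h)
      where
      partSums≈ : IsVertexMagicLabeling A G l → ∀ i j → partSum A part l i ≈ partSum A part l j
      partSums≈ (_ , _ , magic) i j with surj i | surj j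
      ... | u , ≡.refl | v , ≡.refl = Equivalence.to (nbrSum≈⇔partSum≈ u v) (trans (magic u) (sym (magic v)))

      nbrSums-constant : (∀ i j → partSum A part l i ≈ partSum A part l j) →
                         Σ Carrier λ μ → ∀ v → nbrSum A G l v ≈ μ
      nbrSums-constant h = pairwise≈⇒constant (nbrSum A G l)
        λ u v → Equivalence.from (nbrSum≈⇔partSum≈ u v) (h (part u) (part v))

mainTheorem9 : ∀ {c ℓ : Level} (A : AbelianGroup c ℓ) (k N : ℕ) → 2 ≤ k →
    (part : Fin N → Fin k) → (∀ i → ∃ λ v → part v ≡ i) →
    ((l : Fin N → AbelianGroup.Carrier A) → (∀ v → ¬ AbelianGroup._≈_ A (l v) (AbelianGroup.ε A)) →
      (IsVertexMagicLabeling A (completeMultipartite N k part) l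
        ⇔ (∀ i j → AbelianGroup._≈_ A (partSum A part l i) (partSum A part l j))))
    × (IsVertexMagic A (completeMultipartite N k part)
        ⇔ (Σ (Fin N → AbelianGroup.Carrier A) λ l →
             (∀ v → ¬ AbelianGroup._≈_ A (l v) (AbelianGroup.ε A))
             × (∀ i j → AbelianGroup._≈_ A (partSum A part l i) (partSum A part l j))))
mainTheorem9 A k N _ part surj = (λ l → vertexMagic⇔partSums≈ A part l surj) , mk⇔
  (λ (l , nonzero , magic) → l , nonzero , Equivalence.to (vertexMagic⇔partSums≈ A part l surj nonzero) (nonzero , magic))
  (λ (l , nonzero , equal) → l , Equivalence.from (vertexMagic⇔partSums≈ A part l surj nonzero) equal)
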